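{- For any finite abelian group $(G,+)$, let $\Phi_{H_{\mathrm{cor},G}}$ be the support of the adjacency tensor of $H_{\mathrm{cor},G}$. Then $\Phi_{H_{\mathrm{cor},G}}$ is tight.
   Context: $H_{\mathrm{cor},G}$ is the directed $3$-uniform hypergraph with vertex set $V=G\times G$ and edges $((g_1,g_2),(g_1+\lambda,g_2),(g_1,g_2+\lambda))$ for $g_1,g_2,\lambda\in G$, $\lambda\neq0$. The support of its adjacency tensor is $\Phi_{H_{\mathrm{cor},G}}=E\cup\{(v,v,v):v\in V\}\subseteq V\times V\times V$. A subset $\Phi\subseteq I_1\times\dots\times I_k$ of a product of finite sets is tight if there are injective maps $u_i:I_i\to\mathbb{Z}$ ($i\in[k]$) with $u_1(a_1)+\dots+u_k(a_k)=0$ for every $(a_1,\dots,a_k)\in\Phi$. -}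

module Defs where

open import Level using (Level; _⊔_)
open import Algebra.Bundles using (AbelianGroup)
open import Relation.Binary.Bundles using (Setoid)
open import Relation.Binary.PropositionalEquality as ≡ using (_≡_)
open import Data.Fin using (Fin)
open import Data.Nat using (ℕ)
open import Data.Integer using (ℤ; _+_; 0ℤ)
open import Data.Product using (Σ; ∃; _×_; _,_)
open import Data.Product.Relation.Binary.Pointwise.NonDependent using (×-setoid)
open import Data.Sum using (_⊎_)
open import Function.Bundles using (Inverse; Injection)
open import Relation.Nullary using (¬_)

IsFinite : ∀ {c ℓ} → Setoid c ℓ → Set (c ⊔ ℓ)
IsFinite S = ∃ λ (n : ℕ) → Inverse S (≡.setoid (Fin n))

Tight : ∀ {c ℓ r} (I₁ I₂ I₃ : Setoid c ℓ) →
        (Setoid.Carrier I₁ → Setoid.Carrier I₂ → Setoid.Carrier I₃ → Set r) →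
        Set (c ⊔ ℓ ⊔ r)
Tight I₁ I₂ I₃ Φ =
  Σ (Injection I₁ (≡.setoid ℤ)) λ u₁ →
  Σ (Injection I₂ (≡.setoid ℤ)) λ u₂ →
  Σ (Injection I₃ (≡.setoid ℤ)) λ u₃ →
    ∀ a₁ a₂ a₃ → Φ a₁ a₂ a₃ →
      Injection.to u₁ a₁ + Injection.to u₂ a₂ + Injection.to u₃ a₃ ≡ 0ℤ

module Corner {c ℓ} (G : AbelianGroup c ℓ) where
  open AbelianGroup G renaming (Carrier to A)

  V : Setoid c ℓ
  V = ×-setoid setoid setoid

  Edge : (A × A) → (A × A) → (A × A) → Set (c ⊔ ℓ)
  Edge v₁ v₂ v₃ = ∃ λ (g₁ : A) → ∃ λ (g₂ : A) → ∃ λ (l : A) →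
    ¬ (l ≈ ε) × (Setoid._≈_ V v₁ (g₁ , g₂)
               × Setoid._≈_ V v₂ (g₁ ∙ l , g₂)
               × Setoid._≈_ V v₃ (g₁ , g₂ ∙ l))

  Diag : (A × A) → (A × A) → (A × A) → Set ℓ
  Diag v₁ v₂ v₃ = Setoid._≈_ V v₁ v₂ × Setoid._≈_ V v₁ v₃

  Φcor : (A × A) → (A × A) → (A × A) → Set (c ⊔ ℓ)
  Φcor v₁ v₂ v₃ = Edge v₁ v₂ v₃ ⊎ Diag v₁ v₂ v₃

{-# OPTIONS --safe #-}
module Submission where

-- Every triple of Φcor is aligned: v₁ and v₃ share their first coordinate,
-- v₁ and v₂ their second, and v₂ and v₃ the sum of their coordinates.
-- Index the group by 0, …, n − 1 and write a, b, s for the indices of x, y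
-- and x ∙ y at a vertex (x , y). Then u₁ = −(a + b n²), u₂ = s n + b n² and
-- u₃ = a − s n sum to zero on aligned triples, and each is injective by
-- uniqueness of base-n digits, since a vertex is determined by any two of
-- x, y and x ∙ y.

open import Defs
open import Algebra.Bundles using (AbelianGroup)
import Algebra.Properties.AbelianGroup as AbelianGroupProperties
open import Data.Fin using (Fin; toℕ)
open import Data.Fin.Properties using (toℕ<n; toℕ-injective)
open import Data.Integer as ℤ using (ℤ; +_; -_; _-_; 0ℤ)
import Data.Integer.Properties as ℤ
import Data.Integer.Tactic.RingSolver as ℤ-Solver
open import Data.Nat as ℕ using (ℕ; >-nonZero)
import Data.Nat.Properties as ℕ
import Data.Nat.Tactic.RingSolver as ℕ-Solver
open import Data.Nat.DivMod using (_%_; m<n⇒m%n≡m; [m+kn]%n≡m%n)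
open import Data.Product using (_×_; _,_)
open import Data.Sum using (inj₁; inj₂)
open import Function.Base using (_∘_)
open import Function.Bundles using (Injection)
open import Function.Properties.Inverse using (Inverse⇒Injection)
open import Relation.Binary.Bundles using (Setoid)
open import Relation.Binary.PropositionalEquality as ≡ using (_≡_; cong)
import Relation.Binary.Reasoning.Setoid as SetoidReasoning

Tight-⊆ : ∀ {c ℓ r s} {I₁ I₂ I₃ : Setoid c ℓ}
          {Φ : Setoid.Carrier I₁ → Setoid.Carrier I₂ → Setoid.Carrier I₃ → Set r}
          {Ψ : Setoid.Carrier I₁ → Setoid.Carrier I₂ → Setoid.Carrier I₃ → Set s} →
          (∀ {a₁ a₂ a₃} → Φ a₁ a₂ a₃ → Ψ a₁ a₂ a₃) →
          Tight I₁ I₂ I₃ Ψ → Tight I₁ I₂ I₃ Φ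
Tight-⊆ Φ⊆Ψ (u₁ , u₂ , u₃ , sum≡0) = u₁ , u₂ , u₃ , λ a₁ a₂ a₃ → sum≡0 a₁ a₂ a₃ ∘ Φ⊆Ψ

digits-injective : ∀ {n q q′ p p′} → q ℕ.< n → q′ ℕ.< n →
                   q ℕ.+ p ℕ.* n ≡ q′ ℕ.+ p′ ℕ.* n → q ≡ q′ × p ≡ p′
digits-injective {n} {q} {q′} {p} {p′} q<n q′<n eq = q≡q′ , p≡p′
  where
  instance _ = >-nonZero (ℕ.m<n⇒0<n q<n)
  open ≡.≡-Reasoning

  q≡q′ : q ≡ q′
  q≡q′ = begin
    q                     ≡⟨ m<n⇒m%n≡m q<n ⟨
    q % n                 ≡⟨ [m+kn]%n≡m%n q p n ⟨
    (q ℕ.+ p ℕ.* n) % n   ≡⟨ cong (_% n) eq ⟩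
    (q′ ℕ.+ p′ ℕ.* n) % n ≡⟨ [m+kn]%n≡m%n q′ p′ n ⟩
    q′ % n                ≡⟨ m<n⇒m%n≡m q′<n ⟩
    q′                    ∎

  p≡p′ : p ≡ p′
  p≡p′ = ℕ.*-cancelʳ-≡ p p′ n (ℕ.+-cancelˡ-≡ q _ _ (≡.trans eq (cong (ℕ._+ p′ ℕ.* n) (≡.sym q≡q′))))

-- Here and below, + (i ℕ.+ l) and + i ℤ.+ + l are definitionally equal.
i-j≡k-l⇒i+l≡k+j : ∀ i j k l → + i - + j ≡ + k - + l → i ℕ.+ l ≡ k ℕ.+ j
i-j≡k-l⇒i+l≡k+j i j k l eq = ℤ.+-injective (begin
  + i ℤ.+ + l                      ≡⟨ regroup (+ i) (+ j) (+ l) ⟩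
  (+ i - + j) ℤ.+ (+ j ℤ.+ + l)    ≡⟨ cong (ℤ._+ (+ j ℤ.+ + l)) eq ⟩
  (+ k - + l) ℤ.+ (+ j ℤ.+ + l)    ≡⟨ regroup′ (+ k) (+ l) (+ j) ⟩
  + k ℤ.+ + j                      ∎)
  where
  open ≡.≡-Reasoning
  regroup : ∀ a b d → a ℤ.+ d ≡ (a - b) ℤ.+ (b ℤ.+ d)
  regroup = ℤ-Solver.solve-∀
  regroup′ : ∀ a b d → (a - b) ℤ.+ (d ℤ.+ b) ≡ a ℤ.+ d
  regroup′ = ℤ-Solver.solve-∀

corner-sum≡0 : ∀ n a b s →
  - + (a ℕ.+ b ℕ.* n ℕ.* n) ℤ.+ + ((s ℕ.+ b ℕ.* n) ℕ.* n) ℤ.+ (+ a - + (s ℕ.* n)) ≡ 0ℤ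
corner-sum≡0 n a b s = begin
  - + A ℤ.+ + B ℤ.+ (+ C - + D)   ≡⟨ regroup (+ A) (+ B) (+ C) (+ D) ⟩
  + (B ℕ.+ C) - + (A ℕ.+ D)       ≡⟨ cong (λ t → + t - + (A ℕ.+ D)) (balanced n a b s) ⟩
  + (A ℕ.+ D) - + (A ℕ.+ D)       ≡⟨ ℤ.+-inverseʳ (+ (A ℕ.+ D)) ⟩
  0ℤ                              ∎
  where
  open ≡.≡-Reasoning
  A = a ℕ.+ b ℕ.* n ℕ.* n
  B = (s ℕ.+ b ℕ.* n) ℕ.* n
  C = a
  D = s ℕ.* n
  regroup : ∀ w x y z → - w ℤ.+ x ℤ.+ (y - z) ≡ (x ℤ.+ y) - (w ℤ.+ z)
  regroup = ℤ-Solver.solve-∀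
  balanced : ∀ n a b s → (s ℕ.+ b ℕ.* n) ℕ.* n ℕ.+ a ≡ a ℕ.+ b ℕ.* n ℕ.* n ℕ.+ s ℕ.* n
  balanced = ℕ-Solver.solve-∀

module _ {c ℓ} (G : AbelianGroup c ℓ) where
  open AbelianGroup G
    using (setoid; _≈_; _∙_; ε; sym; trans; ∙-cong; ∙-congˡ; ∙-congʳ; assoc; comm)
    renaming (Carrier to A)
  open AbelianGroupProperties G using (∙-cancelˡ; ∙-cancelʳ)
  open Corner G

  Aligned : A × A → A × A → A × A → Set ℓ
  Aligned (x₁ , y₁) (x₂ , y₂) (x₃ , y₃) = x₁ ≈ x₃ × y₁ ≈ y₂ × x₂ ∙ y₂ ≈ x₃ ∙ y₃

  Φcor⇒Aligned : ∀ {v₁ v₂ v₃} → Φcor v₁ v₂ v₃ → Aligned v₁ v₂ v₃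
  Φcor⇒Aligned {x₁ , y₁} {x₂ , y₂} {x₃ , y₃}
    (inj₁ (g₁ , g₂ , l , _ , (x₁≈ , y₁≈) , (x₂≈ , y₂≈) , (x₃≈ , y₃≈))) =
    trans x₁≈ (sym x₃≈) , trans y₁≈ (sym y₂≈) , sum≈
    where
    open SetoidReasoning setoid
    sum≈ : x₂ ∙ y₂ ≈ x₃ ∙ y₃
    sum≈ = begin
      x₂ ∙ y₂          ≈⟨ ∙-cong x₂≈ y₂≈ ⟩
      (g₁ ∙ l) ∙ g₂    ≈⟨ assoc g₁ l g₂ ⟩
      g₁ ∙ (l ∙ g₂)    ≈⟨ ∙-congˡ (comm l g₂) ⟩
      g₁ ∙ (g₂ ∙ l)    ≈⟨ ∙-cong x₃≈ y₃≈ ⟨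
      x₃ ∙ y₃          ∎
  Φcor⇒Aligned (inj₂ ((x₁≈x₂ , y₁≈y₂) , (x₁≈x₃ , y₁≈y₃))) =
    x₁≈x₃ , y₁≈y₂ , trans (∙-cong (sym x₁≈x₂) (sym y₁≈y₂)) (∙-cong x₁≈x₃ y₁≈y₃)

  module _ {n} (index : Injection setoid (≡.setoid (Fin n))) where
    open Injection index using (to) renaming (cong to to-cong; injective to to-injective)

    ι : A → ℕ
    ι = toℕ ∘ to

    ι-cong : ∀ {x y} → x ≈ y → ι x ≡ ι y
    ι-cong = cong toℕ ∘ to-cong

    ι-digits-injective : ∀ {x x′ p p′} → ι x ℕ.+ p ℕ.* n ≡ ι x′ ℕ.+ p′ ℕ.* n → x ≈ x′ × p ≡ p′
    ι-digits-injective {x} {x′} eq with digits-injective (toℕ<n (to x)) (toℕ<n (to x′)) eq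
    ... | ιx≡ιx′ , p≡p′ = to-injective (toℕ-injective ιx≡ιx′) , p≡p′

    instance _ = >-nonZero (ℕ.m<n⇒0<n (toℕ<n (to ε)))

    u₁ : Injection V (≡.setoid ℤ)
    u₁ = record
      { to        = λ (x , y) → - + (ι x ℕ.+ ι y ℕ.* n ℕ.* n)
      ; cong      = λ (x≈ , y≈) → ≡.cong₂ (λ a b → - + (a ℕ.+ b ℕ.* n ℕ.* n)) (ι-cong x≈) (ι-cong y≈)
      ; injective = λ eq →
          let x≈ , ιy*n≡ = ι-digits-injective (ℤ.+-injective (ℤ.neg-injective eq))
          in x≈ , to-injective (toℕ-injective (ℕ.*-cancelʳ-≡ _ _ n ιy*n≡))
      }

    u₂ : Injection V (≡.setoid ℤ)
    u₂ = record
      { to        = λ (x , y) → + ((ι (x ∙ y) ℕ.+ ι y ℕ.* n) ℕ.* n)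
      ; cong      = λ (x≈ , y≈) → ≡.cong₂ (λ s b → + ((s ℕ.+ b ℕ.* n) ℕ.* n)) (ι-cong (∙-cong x≈ y≈)) (ι-cong y≈)
      ; injective = λ {(x , y)} {(x′ , y′)} eq →
          let s≈ , ιy≡ = ι-digits-injective (ℕ.*-cancelʳ-≡ _ _ n (ℤ.+-injective eq))
              y≈ = to-injective (toℕ-injective ιy≡)
          in ∙-cancelʳ y x x′ (trans s≈ (∙-congˡ (sym y≈))) , y≈
      }

    u₃ : Injection V (≡.setoid ℤ)
    u₃ = record
      { to        = λ (x , y) → + ι x - + (ι (x ∙ y) ℕ.* n)
      ; cong      = λ (x≈ , y≈) → ≡.cong₂ (λ a s → + a - + (s ℕ.* n)) (ι-cong x≈) (ι-cong (∙-cong x≈ y≈))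
      ; injective = λ {(x , y)} {(x′ , y′)} eq →
          let x≈ , ιs′≡ = ι-digits-injective (i-j≡k-l⇒i+l≡k+j (ι x) _ (ι x′) _ eq)
              s≈ = to-injective (toℕ-injective (≡.sym ιs′≡))
          in x≈ , ∙-cancelˡ x y y′ (trans s≈ (∙-congʳ (sym x≈)))
      }

    Aligned-tight : Tight V V V Aligned
    Aligned-tight = u₁ , u₂ , u₃ , sum≡0
      where
      sum≡0 : ∀ v₁ v₂ v₃ → Aligned v₁ v₂ v₃ →
              Injection.to u₁ v₁ ℤ.+ Injection.to u₂ v₂ ℤ.+ Injection.to u₃ v₃ ≡ 0ℤ
      sum≡0 (x₁ , y₁) (x₂ , y₂) (x₃ , y₃) (x₁≈x₃ , y₁≈y₂ , s₂≈s₃)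
        rewrite ι-cong x₁≈x₃ | ι-cong y₁≈y₂ | ι-cong s₂≈s₃
        = corner-sum≡0 n (ι x₃) (ι y₂) (ι (x₃ ∙ y₃))

theorem3p5 : ∀ {c ℓ} (G : AbelianGroup c ℓ) → IsFinite (AbelianGroup.setoid G) →
    let open Corner G in Tight V V V Φcor
theorem3p5 G (_ , G↔Fin) = Tight-⊆ (Φcor⇒Aligned G) (Aligned-tight G (Inverse⇒Injection G↔Fin))
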